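{- Let $\mathrm{P}\in\{\mathrm{ICK},\mathrm{ICKT},\mathrm{ICKS4}\}$ and let $\varphi,\psi$ be formulae. If $\vdash_{\mathrm{P}}\varphi\vee\psi$, then $\vdash_{\mathrm{P}}\varphi$ or $\vdash_{\mathrm{P}}\psi$.
   Context: Formulae over a finite non-empty set $\mathsf{A}$ of agents and atoms $\mathrm{Prop}$: $\varphi ::= \bot \mid p \mid \varphi\wedge\varphi\mid\varphi\vee\varphi\mid\varphi\to\varphi\mid K_a\varphi\mid C\varphi$; $E\varphi:=\bigwedge_aK_a\varphi$. Hilbert systems: axiom schemes Int (uniform substitution instances of intuitionistic propositional tautologies), $\mathsf{K}_a$: $K_a(\varphi\to\psi)\to(K_a\varphi\to K_a\psi)$, $\mathsf{T}_a$: $K_a\varphi\to\varphi$, $\mathsf{S4}_a$: $K_a\varphi\to K_aK_a\varphi$, Fix: $C\varphi\leftrightarrow(\varphi\wedge EC\varphi)$; rules MP, $\mathsf{Nec}_a$ (from $\varphi$ infer $K_a\varphi$), Mon (from $\varphi\to\psi$ infer $C\varphi\to C\psi$), Ind (from $\varphi\to E\varphi$ infer $\varphi\to C\varphi$). $\mathrm{ICK}$: Int, $\mathsf{K}_a$ for all $a$, Fix and all four rules; $\mathrm{ICKT}$ adds $\mathsf{T}_a$; $\mathrm{ICKS4}$ further adds $\mathsf{S4}_a$. $\vdash_{\mathrm{P}}\varphi$ means $\varphi$ has a finite derivation tree from axioms of $\mathrm{P}$ via its rules. -}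

module Defs where

open import Data.Nat using (ℕ; zero; suc)
open import Data.Fin using (Fin; zero; suc)
open import Data.Unit using (⊤)
open import Data.Empty using (⊥)

data PForm : Set where
  pbot : PForm
  pvar : ℕ → PForm
  _p∧_ _p∨_ _p→_ : PForm → PForm → PForm

infixr 6 _p∧_
infixr 5 _p∨_
infixr 4 _p→_

data IPC : PForm → Set where
  ax1 : ∀ A B → IPC (A p→ (B p→ A))
  ax2 : ∀ A B C → IPC ((A p→ (B p→ C)) p→ ((A p→ B) p→ (A p→ C)))
  ax3 : ∀ A B → IPC ((A p∧ B) p→ A)
  ax4 : ∀ A B → IPC ((A p∧ B) p→ B)
  ax5 : ∀ A B → IPC (A p→ (B p→ (A p∧ B)))
  ax6 : ∀ A B → IPC (A p→ (A p∨ B))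
  ax7 : ∀ A B → IPC (B p→ (A p∨ B))
  ax8 : ∀ A B C → IPC ((A p→ C) p→ ((B p→ C) p→ ((A p∨ B) p→ C)))
  ax9 : ∀ A → IPC (pbot p→ A)
  mp  : ∀ {A B} → IPC (A p→ B) → IPC A → IPC B

data Form (m : ℕ) : Set where
  ⊥′  : Form m
  var : ℕ → Form m
  _∧_ _∨_ _⇒_ : Form m → Form m → Form m
  K   : Fin (suc m) → Form m → Form m
  C   : Form m → Form m

infixr 6 _∧_
infixr 5 _∨_
infixr 4 _⇒_

_⇔_ : ∀ {m} → Form m → Form m → Form m
φ ⇔ ψ = (φ ⇒ ψ) ∧ (ψ ⇒ φ)

bigAnd : ∀ k {m} → (Fin (suc k) → Form m) → Form m
bigAnd zero    f = f zero
bigAnd (suc k) f = f zero ∧ bigAnd k (λ i → f (suc i))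

E : ∀ {m} → Form m → Form m
E {m} φ = bigAnd m (λ a → K a φ)

subst : ∀ {m} → (ℕ → Form m) → PForm → Form m
subst σ pbot      = ⊥′
subst σ (pvar p)  = σ p
subst σ (A p∧ B)  = subst σ A ∧ subst σ B
subst σ (A p∨ B)  = subst σ A ∨ subst σ B
subst σ (A p→ B)  = subst σ A ⇒ subst σ B

data Logic : Set where
  ICK ICKT ICKS4 : Logic

HasT : Logic → Set
HasT ICK   = ⊥
HasT ICKT  = ⊤
HasT ICKS4 = ⊤

HasS4 : Logic → Set
HasS4 ICK   = ⊥
HasS4 ICKT  = ⊥
HasS4 ICKS4 = ⊤

data _⊢_ {m : ℕ} (P : Logic) : Form m → Set where
  Int  : ∀ {A} → IPC A → (σ : ℕ → Form m) → P ⊢ subst σ A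
  Kax  : ∀ a φ ψ → P ⊢ (K a (φ ⇒ ψ) ⇒ (K a φ ⇒ K a ψ))
  Tax  : HasT P → ∀ a φ → P ⊢ (K a φ ⇒ φ)
  S4ax : HasS4 P → ∀ a φ → P ⊢ (K a φ ⇒ K a (K a φ))
  Fix  : ∀ φ → P ⊢ (C φ ⇔ (φ ∧ E (C φ)))
  MP   : ∀ {φ ψ} → P ⊢ (φ ⇒ ψ) → P ⊢ φ → P ⊢ ψ
  Nec  : ∀ a {φ} → P ⊢ φ → P ⊢ K a φ
  Mon  : ∀ {φ ψ} → P ⊢ (φ ⇒ ψ) → P ⊢ (C φ ⇒ C ψ)
  Ind  : ∀ {φ} → P ⊢ (φ ⇒ E φ) → P ⊢ (φ ⇒ C φ)

infix 2 _⊢_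

-- Aczel's slash: call φ slashed when it is derivable and, hereditarily, its
-- main connective is witnessed — a slashed disjunction has a slashed disjunct,
-- a slashed implication maps slashes to slashes.  Slashed formulae are
-- derivable, and by induction on derivations every theorem is slashed, so a
-- derivable disjunction has a derivable disjunct.  Slashing K_a φ or C φ
-- requires only a derivation and a slash of φ: this is exactly what T needs,
-- and it makes Nec and Ind sound because their conclusions are derivable.
{-# OPTIONS --safe #-}
module Submission where

open import Defs
open import Data.Nat using (ℕ; zero; suc)
open import Data.Fin using (Fin; zero; suc)
open import Data.Sum as Sum using (_⊎_; inj₁; inj₂; [_,_])
open import Data.Product using (_×_; _,_; proj₁; proj₂)
open import Data.Empty renaming (⊥ to Empty)

module _ {m : ℕ} {P : Logic} {φ ψ : Form m} where

  private
    ⟨_,_⟩ : Form m → Form m → ℕ → Form m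
    ⟨ χ , _ ⟩ zero    = χ
    ⟨ _ , χ ⟩ (suc _) = χ

    p₀ p₁ : PForm
    p₀ = pvar 0
    p₁ = pvar 1

  ∧-intro : P ⊢ φ → P ⊢ ψ → P ⊢ φ ∧ ψ
  ∧-intro d e = MP (MP (Int (ax5 p₀ p₁) ⟨ φ , ψ ⟩) d) e

  ∧-elimˡ : P ⊢ φ ∧ ψ → P ⊢ φ
  ∧-elimˡ = MP (Int (ax3 p₀ p₁) ⟨ φ , ψ ⟩)

  ∧-elimʳ : P ⊢ φ ∧ ψ → P ⊢ ψ
  ∧-elimʳ = MP (Int (ax4 p₀ p₁) ⟨ φ , ψ ⟩)

  ∨-introˡ : P ⊢ φ → P ⊢ φ ∨ ψ
  ∨-introˡ = MP (Int (ax6 p₀ p₁) ⟨ φ , ψ ⟩)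

  ∨-introʳ : P ⊢ ψ → P ⊢ φ ∨ ψ
  ∨-introʳ = MP (Int (ax7 p₀ p₁) ⟨ φ , ψ ⟩)

module AczelSlash {m : ℕ} (P : Logic) where

  Slash : Form m → Set
  Slash ⊥′      = Empty
  Slash (var p) = P ⊢ var {m} p
  Slash (φ ∧ ψ) = Slash φ × Slash ψ
  Slash (φ ∨ ψ) = Slash φ ⊎ Slash ψ
  Slash (φ ⇒ ψ) = (P ⊢ φ ⇒ ψ) × (Slash φ → Slash ψ)
  Slash (K a φ) = (P ⊢ K a φ) × Slash φ
  Slash (C φ)   = (P ⊢ C φ) × Slash φ

  slash⇒⊢ : ∀ φ → Slash φ → P ⊢ φ
  slash⇒⊢ ⊥′      ()
  slash⇒⊢ (var p) d        = d
  slash⇒⊢ (φ ∧ ψ) (s , t)  = ∧-intro (slash⇒⊢ φ s) (slash⇒⊢ ψ t)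
  slash⇒⊢ (φ ∨ ψ) (inj₁ s) = ∨-introˡ (slash⇒⊢ φ s)
  slash⇒⊢ (φ ∨ ψ) (inj₂ t) = ∨-introʳ (slash⇒⊢ ψ t)
  slash⇒⊢ (φ ⇒ ψ) (d , _)  = d
  slash⇒⊢ (K a φ) (d , _)  = d
  slash⇒⊢ (C φ)   (d , _)  = d

  infixl 5 _·_

  _·_ : ∀ {φ ψ} → P ⊢ φ ⇒ ψ → Slash φ → P ⊢ ψ
  d · s = MP d (slash⇒⊢ _ s)

  slash-bigAnd : ∀ k (f : Fin (suc k) → Form m) → (∀ i → Slash (f i)) →
                 Slash (bigAnd k f)
  slash-bigAnd zero    f s = s zero
  slash-bigAnd (suc k) f s = s zero , slash-bigAnd k (λ i → f (suc i)) (λ i → s (suc i))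

  slash-Int : ∀ {A} → IPC A → (σ : ℕ → Form m) → Slash (subst σ A)
  slash-Int d@(ax1 _ _)   σ = Int d σ , λ a → Int d σ · a , λ _ → a
  slash-Int d@(ax2 _ _ _) σ = Int d σ , λ f → Int d σ · f , λ g → Int d σ · f · g ,
                              λ a → proj₂ (proj₂ f a) (proj₂ g a)
  slash-Int d@(ax3 _ _)   σ = Int d σ , proj₁
  slash-Int d@(ax4 _ _)   σ = Int d σ , proj₂
  slash-Int d@(ax5 _ _)   σ = Int d σ , λ a → Int d σ · a , λ b → a , b
  slash-Int d@(ax6 _ _)   σ = Int d σ , inj₁
  slash-Int d@(ax7 _ _)   σ = Int d σ , inj₂
  slash-Int d@(ax8 _ _ _) σ = Int d σ , λ f → Int d σ · f , λ g → Int d σ · f · g ,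
                              [ proj₂ f , proj₂ g ]
  slash-Int d@(ax9 _)     σ = Int d σ , λ ()
  slash-Int (mp d e)      σ = proj₂ (slash-Int d σ) (slash-Int e σ)

  ⊢⇒slash : ∀ {φ} → P ⊢ φ → Slash φ
  ⊢⇒slash (Int d σ)      = slash-Int d σ
  ⊢⇒slash d@(Kax _ _ _)  = d , λ f → d · f , λ a → d · f · a , proj₂ (proj₂ f) (proj₂ a)
  ⊢⇒slash d@(Tax _ _ _)  = d , proj₂
  ⊢⇒slash d@(S4ax _ _ _) = d , λ a → d · a , a
  ⊢⇒slash (Fix φ)        =
    (∧-elimˡ (Fix φ) , λ c → proj₂ c , slash-bigAnd m _ (λ a → Nec a (proj₁ c) , c)) ,
    (∧-elimʳ (Fix φ) , λ s → ∧-elimʳ (Fix φ) · s , proj₁ s)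
  ⊢⇒slash (MP d e)       = proj₂ (⊢⇒slash d) (⊢⇒slash e)
  ⊢⇒slash (Nec a d)      = Nec a d , ⊢⇒slash d
  ⊢⇒slash d@(Mon e)      = d , λ c → d · c , proj₂ (⊢⇒slash e) (proj₂ c)
  ⊢⇒slash d@(Ind _)      = d , λ s → d · s , s

mainTheorem10 : (m : ℕ) (P : Logic) (φ ψ : Form m) →
    P ⊢ (φ ∨ ψ) → (P ⊢ φ) ⊎ (P ⊢ ψ)
mainTheorem10 m P φ ψ d = Sum.map (slash⇒⊢ φ) (slash⇒⊢ ψ) (⊢⇒slash d)
  where open AczelSlash {m} P
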